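{- Let $k,m\in\mathbb N_0$ with $0\leq k\leq m$, and let $a$ be a number. Then $$\sum_{\substack{i=0\\ m+i~\text{even}}}^{m}\binom mi\binom{m+i}{k}E_{m+i-k}(a)=\sum_{j=0}^m(-1)^{m+j}\binom mj\binom{m+j}{k}a^{m+j-k},$$ where the left-hand sum runs over those $i\in\{0,\dots,m\}$ with $m+i$ even.
   Context: The Euler polynomials $E_n(a)$ are defined by $\frac{2e^{at}}{e^t+1}=\sum_{n=0}^\infty E_n(a)\frac{t^n}{n!}$; $\binom{N}{k}$ denotes the binomial coefficient. -}

module Defs where

open import Data.Nat as ℕ using (ℕ; zero; suc; _%_; _≡ᵇ_)
open import Data.Nat.Combinatorics using (_C_)
open import Data.Integer using (+_)
open import Data.Rational using (ℚ; 0ℚ; 1ℚ; _+_; _*_; _-_; -_; ½; _/_)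
open import Data.List using (List; map; upTo; foldr)
open import Data.Vec using (Vec; []; _∷_; _∷ʳ_; lookup; fromList)
open import Data.Fin using (Fin; fromℕ; fromℕ<)
open import Data.Bool using (if_then_else_)
open import Relation.Nullary.Decidable using (toWitness)

pow : ℚ → ℕ → ℚ
pow q zero    = 1ℚ
pow q (suc n) = q * pow q n

ℕ→ℚ : ℕ → ℚ
ℕ→ℚ n = + n / 1

Σ≤ : ℕ → (ℕ → ℚ) → ℚ
Σ≤ n f = foldr _+_ 0ℚ (map f (upTo (suc n)))

Σ< : ℕ → (ℕ → ℚ) → ℚ
Σ< n f = foldr _+_ 0ℚ (map f (upTo n))

-- Euler polynomials E_n(a), defined by comparing coefficients of t^n/n! in
--   (e^t + 1) · Σ E_n(a) t^n/n! = 2 e^{at},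
-- i.e.  Σ_{k=0}^{n} C(n,k) E_k(a) + E_n(a) = 2 a^n, equivalently
--   E_n(a) = a^n - ½ Σ_{k=0}^{n-1} C(n,k) E_k(a).
-- eulerTable a n = (E_0(a), …, E_n(a))
eulerTable : ℚ → (n : ℕ) → Vec ℚ (suc n)
eulerTable a zero    = 1ℚ ∷ []
eulerTable a (suc n) =
  let prev = eulerTable a n
      get : ℕ → ℚ
      get k = lookupℕ prev k
  in prev ∷ʳ (pow a (suc n) - ½ * Σ< (suc n) (λ k → ℕ→ℚ (suc n C k) * get k))
  where
  lookupℕ : ∀ {m} → Vec ℚ m → ℕ → ℚ
  lookupℕ []       _       = 0ℚ
  lookupℕ (x ∷ xs) zero    = x
  lookupℕ (x ∷ xs) (suc k) = lookupℕ xs k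

E : ℕ → ℚ → ℚ
E n a = lookup (eulerTable a n) (fromℕ n)

sign : ℕ → ℚ
sign n = pow (- 1ℚ) n

evenInd : ℕ → ℚ
evenInd n = if (n % 2) ≡ᵇ 0 then 1ℚ else 0ℚ

module Submission where

-- Write B T n = Σₗ C(n,l) T l for the binomial transform and Δ for the forward difference.
-- The Euler polynomials are defined by ½ (B E + E) = a^•, and this relation is inherited by
-- ∂[k] U l = C(l,k) U (l - k). Since Δ (B T) = B (T ∘ suc), the m-th difference of B T at m
-- is Σᵢ C(m,i) T (m+i), whereas that of T is Σᵢ (-1)^(m+i) C(m,i) T (m+i). Their average is
-- the left-hand side for T = ∂[k] E, and it is the m-th difference of ½ (B T + T) = ∂[k] a^•
-- at m, which is the right-hand side.

open import Defs
open import Data.Nat using (ℕ; _+_; _∸_; _≤_)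
open import Data.Nat.Combinatorics using (_C_)
open import Data.Rational using (ℚ) renaming (_*_ to _*ℚ_)
open import Relation.Binary.PropositionalEquality using (_≡_)

open import Algebra.Bundles using (CommutativeRing)
open import Data.Fin using (toℕ; fromℕ; inject₁)
open import Data.Fin.Properties using (toℕ<n; toℕ-fromℕ; toℕ-inject₁)
import Data.Integer as ℤ
import Data.Integer.Properties as ℤ
open import Data.List using (foldr; map; applyUpTo)
open import Data.Nat using (zero; suc; _<_; s≤s; _<?_)
open import Data.Nat.Combinatorics using (nCk+nC[k+1]≡[n+1]C[k+1]; nCn≡1; k>n⇒nCk≡0)
open import Data.Nat.Coprimality using (1-coprimeTo) renaming (sym to coprime-sym)
open import Data.Nat.Properties using (+-suc; +-identityʳ; +-∸-assoc; ≤-pred; ≮⇒≥; n<1+n; m≤n⇒m<n∨m≡n)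
open import Data.Rational using (0ℚ; 1ℚ; ½; _/_) renaming (_+_ to _+ℚ_; _-_ to _-ℚ_)
open import Data.Rational.Properties using (+-*-commutativeRing; normalize-coprime; +-comm; *-zeroˡ; *-identityˡ; *-distribˡ-+; *-distribʳ-+)
open import Data.Rational.Solver using (module +-*-Solver)
open import Data.Sum using (inj₁; inj₂)
open import Data.Vec using (Vec; []; _∷_; _∷ʳ_; lookup; toList)
open import Relation.Nullary using (yes; no)
open import Relation.Binary.PropositionalEquality using (refl; sym; trans; cong; cong₂; module ≡-Reasoning)
open import Algebra.Properties.Semiring.Sum (CommutativeRing.semiring +-*-commutativeRing)
  using (sum-syntax; ∑-distrib-+; sum-init-last; sum-cong-≗; *-distribˡ-sum)

open +-*-Solver using (solve; _:=_; _:+_; _:*_; _:-_; :-_; con)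
open ≡-Reasoning

Σ<≡∑ : ∀ n (f : ℕ → ℚ) → Σ< n f ≡ ∑[ i < n ] f (toℕ i)
Σ<≡∑ n f = go n (λ i → i)
  where
  go : ∀ n (g : ℕ → ℕ) → foldr _+ℚ_ 0ℚ (map f (applyUpTo g n)) ≡ ∑[ i < n ] f (g (toℕ i))
  go zero    g = refl
  go (suc n) g = cong (f (g 0) +ℚ_) (go n (λ i → g (suc i)))

Σ<-suc : ∀ n (f : ℕ → ℚ) → Σ< (suc n) f ≡ f 0 +ℚ Σ< n (λ i → f (suc i))
Σ<-suc n f = trans (Σ<≡∑ (suc n) f) (cong (f 0 +ℚ_) (sym (Σ<≡∑ n (λ i → f (suc i)))))

Σ<-sucʳ : ∀ n (f : ℕ → ℚ) → Σ< (suc n) f ≡ Σ< n f +ℚ f n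
Σ<-sucʳ n f = begin
  Σ< (suc n) f                                          ≡⟨ Σ<≡∑ (suc n) f ⟩
  ∑[ i < suc n ] f (toℕ i)                              ≡⟨ sum-init-last {n} (λ i → f (toℕ i)) ⟩
  ∑[ i < n ] f (toℕ (inject₁ i)) +ℚ f (toℕ (fromℕ n))
    ≡⟨ cong₂ _+ℚ_ (sum-cong-≗ {n} (λ i → cong f (toℕ-inject₁ i))) (cong f (toℕ-fromℕ n)) ⟩
  ∑[ i < n ] f (toℕ i) +ℚ f n                           ≡⟨ cong (_+ℚ f n) (sym (Σ<≡∑ n f)) ⟩
  Σ< n f +ℚ f n                                         ∎

Σ<-cong-< : ∀ n {f g : ℕ → ℚ} → (∀ i → i < n → f i ≡ g i) → Σ< n f ≡ Σ< n g
Σ<-cong-< n {f} {g} f≡g = begin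
  Σ< n f                   ≡⟨ Σ<≡∑ n f ⟩
  ∑[ i < n ] f (toℕ i)     ≡⟨ sum-cong-≗ (λ i → f≡g (toℕ i) (toℕ<n i)) ⟩
  ∑[ i < n ] g (toℕ i)     ≡⟨ Σ<≡∑ n g ⟨
  Σ< n g                   ∎

Σ<-cong : ∀ n {f g : ℕ → ℚ} → (∀ i → f i ≡ g i) → Σ< n f ≡ Σ< n g
Σ<-cong n f≡g = Σ<-cong-< n (λ i _ → f≡g i)

Σ<-+ : ∀ n (f g : ℕ → ℚ) → Σ< n (λ i → f i +ℚ g i) ≡ Σ< n f +ℚ Σ< n g
Σ<-+ n f g = begin
  Σ< n (λ i → f i +ℚ g i)                     ≡⟨ Σ<≡∑ n _ ⟩
  ∑[ i < n ] (f (toℕ i) +ℚ g (toℕ i))         ≡⟨ ∑-distrib-+ {n} _ _ ⟩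
  ∑[ i < n ] f (toℕ i) +ℚ ∑[ i < n ] g (toℕ i) ≡⟨ cong₂ _+ℚ_ (Σ<≡∑ n f) (Σ<≡∑ n g) ⟨
  Σ< n f +ℚ Σ< n g                            ∎

*-distribˡ-Σ< : ∀ n x (f : ℕ → ℚ) → x *ℚ Σ< n f ≡ Σ< n (λ i → x *ℚ f i)
*-distribˡ-Σ< n x f = begin
  x *ℚ Σ< n f                     ≡⟨ cong (x *ℚ_) (Σ<≡∑ n f) ⟩
  x *ℚ ∑[ i < n ] f (toℕ i)       ≡⟨ *-distribˡ-sum {n} x _ ⟩
  ∑[ i < n ] (x *ℚ f (toℕ i))     ≡⟨ Σ<≡∑ n _ ⟨
  Σ< n (λ i → x *ℚ f i)           ∎

ℕ→ℚ-+ : ∀ x y → ℕ→ℚ (x + y) ≡ ℕ→ℚ x +ℚ ℕ→ℚ y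
ℕ→ℚ-+ x y = sym (begin
  ℕ→ℚ x +ℚ ℕ→ℚ y
    ≡⟨ cong₂ _+ℚ_ (normalize-coprime (coprime-sym (1-coprimeTo x))) (normalize-coprime (coprime-sym (1-coprimeTo y))) ⟩
  (ℤ.+ x ℤ.* ℤ.+ 1 ℤ.+ ℤ.+ y ℤ.* ℤ.+ 1) / 1
    ≡⟨ cong₂ (λ p q → (p ℤ.+ q) / 1) (ℤ.*-identityʳ (ℤ.+ x)) (ℤ.*-identityʳ (ℤ.+ y)) ⟩
  ℕ→ℚ (x + y) ∎)

binom : ℕ → ℕ → ℚ
binom n k = ℕ→ℚ (n C k)

binom-pascal : ∀ n k → binom (suc n) (suc k) ≡ binom n k +ℚ binom n (suc k)
binom-pascal n k = trans (cong ℕ→ℚ (sym (nCk+nC[k+1]≡[n+1]C[k+1] n k))) (ℕ→ℚ-+ (n C k) (n C suc k))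

binom-vanish : ∀ {n k} → n < k → binom n k ≡ 0ℚ
binom-vanish n<k = cong ℕ→ℚ (k>n⇒nCk≡0 n<k)

binom-diag : ∀ n → binom n n ≡ 1ℚ
binom-diag n = cong ℕ→ℚ (nCn≡1 n)

sign-+2 : ∀ n → sign (suc (suc n)) ≡ sign n
sign-+2 n = solve 1 (λ s → (:- con 1ℚ) :* ((:- con 1ℚ) :* s) := s) refl (sign n)

binomialTransform : (ℕ → ℚ) → ℕ → ℚ
binomialTransform T n = Σ≤ n (λ l → binom n l *ℚ T l)

binomialTransform-cong : ∀ {T U : ℕ → ℚ} → (∀ l → T l ≡ U l) → ∀ n → binomialTransform T n ≡ binomialTransform U n
binomialTransform-cong T≡U n = Σ<-cong (suc n) (λ l → cong (binom n l *ℚ_) (T≡U l))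

binomialTransform-+ : ∀ (T U : ℕ → ℚ) n →
  binomialTransform (λ l → T l +ℚ U l) n ≡ binomialTransform T n +ℚ binomialTransform U n
binomialTransform-+ T U n = trans (Σ<-cong (suc n) (λ l → *-distribˡ-+ (binom n l) (T l) (U l)))
                                  (Σ<-+ (suc n) (λ l → binom n l *ℚ T l) (λ l → binom n l *ℚ U l))

binomialTransform-suc : ∀ (T : ℕ → ℚ) n →
  binomialTransform T (suc n) ≡ binomialTransform T n +ℚ binomialTransform (λ l → T (suc l)) n
binomialTransform-suc T n = begin
  binomialTransform T (suc n)
    ≡⟨ Σ<-suc (suc n) (λ l → binom (suc n) l *ℚ T l) ⟩
  T₀ +ℚ Σ< (suc n) (λ l → binom (suc n) (suc l) *ℚ T′ l)
    ≡⟨ cong (T₀ +ℚ_) (trans (Σ<-cong (suc n) pascal) (Σ<-+ (suc n) lower upper)) ⟩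
  T₀ +ℚ (Σ< (suc n) lower +ℚ Σ< (suc n) upper)
    ≡⟨ solve 3 (λ x y z → x :+ (y :+ z) := x :+ z :+ y) refl T₀ (Σ< (suc n) lower) (Σ< (suc n) upper) ⟩
  T₀ +ℚ Σ< (suc n) upper +ℚ binomialTransform T′ n
    ≡⟨ cong (_+ℚ binomialTransform T′ n) (sym (Σ<-suc (suc n) (λ l → binom n l *ℚ T l))) ⟩
  Σ< (suc (suc n)) (λ l → binom n l *ℚ T l) +ℚ binomialTransform T′ n
    ≡⟨ cong (_+ℚ binomialTransform T′ n) drop-last ⟩
  binomialTransform T n +ℚ binomialTransform T′ n ∎
  where
  T′ : ℕ → ℚ
  T′ l = T (suc l)
  T₀ : ℚ
  T₀ = binom n 0 *ℚ T 0
  lower upper : ℕ → ℚ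
  lower l = binom n l *ℚ T′ l
  upper l = binom n (suc l) *ℚ T′ l
  pascal : ∀ l → binom (suc n) (suc l) *ℚ T′ l ≡ lower l +ℚ upper l
  pascal l = trans (cong (_*ℚ T′ l) (binom-pascal n l)) (*-distribʳ-+ (T′ l) (binom n l) (binom n (suc l)))
  drop-last : Σ< (suc (suc n)) (λ l → binom n l *ℚ T l) ≡ binomialTransform T n
  drop-last = begin
    Σ< (suc (suc n)) (λ l → binom n l *ℚ T l)
      ≡⟨ Σ<-sucʳ (suc n) (λ l → binom n l *ℚ T l) ⟩
    binomialTransform T n +ℚ binom n (suc n) *ℚ T (suc n)
      ≡⟨ cong (λ c → binomialTransform T n +ℚ c *ℚ T (suc n)) (binom-vanish (n<1+n n)) ⟩
    binomialTransform T n +ℚ 0ℚ *ℚ T (suc n)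
      ≡⟨ solve 2 (λ b t → b :+ con 0ℚ :* t := b) refl (binomialTransform T n) (T (suc n)) ⟩
    binomialTransform T n ∎

Δ : (ℕ → ℚ) → ℕ → ℚ
Δ U n = U (suc n) -ℚ U n

Δ^ : ℕ → (ℕ → ℚ) → ℕ → ℚ
Δ^ zero    U = U
Δ^ (suc m) U = Δ^ m (Δ U)

Δ^-cong : ∀ m {U V : ℕ → ℚ} → (∀ l → U l ≡ V l) → ∀ n → Δ^ m U n ≡ Δ^ m V n
Δ^-cong zero    U≡V = U≡V
Δ^-cong (suc m) U≡V = Δ^-cong m (λ l → cong₂ _-ℚ_ (U≡V (suc l)) (U≡V l))

Δ^-+ : ∀ m (U V : ℕ → ℚ) n → Δ^ m (λ l → U l +ℚ V l) n ≡ Δ^ m U n +ℚ Δ^ m V n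
Δ^-+ zero    U V n = refl
Δ^-+ (suc m) U V n = trans (Δ^-cong m Δ-+ n) (Δ^-+ m (Δ U) (Δ V) n)
  where
  Δ-+ : ∀ l → Δ (λ i → U i +ℚ V i) l ≡ Δ U l +ℚ Δ V l
  Δ-+ l = solve 4 (λ u u′ v v′ → (u′ :+ v′) :- (u :+ v) := (u′ :- u) :+ (v′ :- v)) refl (U l) (U (suc l)) (V l) (V (suc l))

Δ^-*ˡ : ∀ m x (U : ℕ → ℚ) n → Δ^ m (λ l → x *ℚ U l) n ≡ x *ℚ Δ^ m U n
Δ^-*ˡ zero    x U n = refl
Δ^-*ˡ (suc m) x U n = trans (Δ^-cong m Δ-*ˡ n) (Δ^-*ˡ m x (Δ U) n)
  where
  Δ-*ˡ : ∀ l → Δ (λ i → x *ℚ U i) l ≡ x *ℚ Δ U l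
  Δ-*ˡ l = solve 3 (λ x u u′ → x :* u′ :- x :* u := x :* (u′ :- u)) refl x (U l) (U (suc l))

Δ-binomialTransform : ∀ (T : ℕ → ℚ) n → Δ (binomialTransform T) n ≡ binomialTransform (λ l → T (suc l)) n
Δ-binomialTransform T n = begin
  binomialTransform T (suc n) -ℚ binomialTransform T n
    ≡⟨ cong (_-ℚ binomialTransform T n) (binomialTransform-suc T n) ⟩
  binomialTransform T n +ℚ binomialTransform (λ l → T (suc l)) n -ℚ binomialTransform T n
    ≡⟨ solve 2 (λ b b′ → b :+ b′ :- b := b′) refl (binomialTransform T n) (binomialTransform (λ l → T (suc l)) n) ⟩
  binomialTransform (λ l → T (suc l)) n ∎

Δ^-binomialTransform : ∀ m (T : ℕ → ℚ) n → Δ^ m (binomialTransform T) n ≡ binomialTransform (λ l → T (m + l)) n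
Δ^-binomialTransform zero    T n = refl
Δ^-binomialTransform (suc m) T n =
  trans (Δ^-cong m (Δ-binomialTransform T) n) (Δ^-binomialTransform m (λ l → T (suc l)) n)

Δ^-alternatingSum : ∀ m (U : ℕ → ℚ) n → Δ^ m U n ≡ Σ≤ m (λ j → sign (m + j) *ℚ (binom m j *ℚ U (n + j)))
Δ^-alternatingSum m U n = trans (Δ^≡binomialTransform m U n) (Σ<-cong (suc m) (λ j →
  solve 3 (λ c s u → c :* (s :* u) := s :* (c :* u)) refl (binom m j) (sign (m + j)) (U (n + j))))
  where
  Δ^≡binomialTransform : ∀ m (U : ℕ → ℚ) n → Δ^ m U n ≡ binomialTransform (λ j → sign (m + j) *ℚ U (n + j)) m
  Δ^≡binomialTransform zero    U n = trans (cong U (sym (+-identityʳ n)))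
    (solve 1 (λ u → u := con 1ℚ :* (con 1ℚ :* u) :+ con 0ℚ) refl (U (n + 0)))
  Δ^≡binomialTransform (suc m) U n = begin
    Δ^ m (Δ U) n
      ≡⟨ Δ^≡binomialTransform m (Δ U) n ⟩
    binomialTransform (λ j → sign (m + j) *ℚ (U (suc (n + j)) -ℚ U (n + j))) m
      ≡⟨ binomialTransform-cong split m ⟩
    binomialTransform (λ j → g j +ℚ sign (m + j) *ℚ U (suc (n + j))) m
      ≡⟨ binomialTransform-+ g (λ j → sign (m + j) *ℚ U (suc (n + j))) m ⟩
    binomialTransform g m +ℚ binomialTransform (λ j → sign (m + j) *ℚ U (suc (n + j))) m
      ≡⟨ cong (binomialTransform g m +ℚ_) (binomialTransform-cong shift m) ⟩
    binomialTransform g m +ℚ binomialTransform (λ j → g (suc j)) m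
      ≡⟨ binomialTransform-suc g m ⟨
    binomialTransform g (suc m) ∎
    where
    g : ℕ → ℚ
    g j = sign (suc m + j) *ℚ U (n + j)
    split : ∀ j → sign (m + j) *ℚ (U (suc (n + j)) -ℚ U (n + j)) ≡ g j +ℚ sign (m + j) *ℚ U (suc (n + j))
    split j = solve 3 (λ s u u′ → s :* (u′ :- u) := (:- con 1ℚ) :* s :* u :+ s :* u′) refl
                (sign (m + j)) (U (n + j)) (U (suc (n + j)))
    shift : ∀ j → sign (m + j) *ℚ U (suc (n + j)) ≡ g (suc j)
    shift j rewrite +-suc m j | +-suc n j = cong (_*ℚ U (suc (n + j))) (sym (sign-+2 (m + j)))

-- For an Appell sequence U l = p_l(a), such as E_l(a) or a^l, ∂[ k ] U is the k-th derivative
-- in a divided by k!.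
∂[_] : ℕ → (ℕ → ℚ) → ℕ → ℚ
∂[ k ] U l = binom l k *ℚ U (l ∸ k)

-- suc (l ∸ suc k) and l ∸ k differ only when l ≤ k, where the coefficient vanishes.
binom-*-∸ : ∀ (V : ℕ → ℚ) l k → binom l (suc k) *ℚ V (suc (l ∸ suc k)) ≡ binom l (suc k) *ℚ V (l ∸ k)
binom-*-∸ V l k with k <? l
... | yes k<l = cong (λ i → binom l (suc k) *ℚ V i) (sym (+-∸-assoc 1 k<l))
... | no  k≮l = begin
  binom l (suc k) *ℚ V (suc (l ∸ suc k)) ≡⟨ cong (_*ℚ V (suc (l ∸ suc k))) vanish ⟩
  0ℚ *ℚ V (suc (l ∸ suc k))              ≡⟨ *-zeroˡ (V (suc (l ∸ suc k))) ⟩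
  0ℚ                                     ≡⟨ *-zeroˡ (V (l ∸ k)) ⟨
  0ℚ *ℚ V (l ∸ k)                        ≡⟨ cong (_*ℚ V (l ∸ k)) vanish ⟨
  binom l (suc k) *ℚ V (l ∸ k)           ∎
  where
  vanish : binom l (suc k) ≡ 0ℚ
  vanish = binom-vanish (s≤s (≮⇒≥ k≮l))

∂-suc : ∀ k (U : ℕ → ℚ) l → ∂[ suc k ] U (suc l) ≡ ∂[ k ] U l +ℚ ∂[ suc k ] (λ i → U (suc i)) l
∂-suc k U l = begin
  binom (suc l) (suc k) *ℚ U (l ∸ k)
    ≡⟨ cong (_*ℚ U (l ∸ k)) (binom-pascal l k) ⟩
  (binom l k +ℚ binom l (suc k)) *ℚ U (l ∸ k)
    ≡⟨ *-distribʳ-+ (U (l ∸ k)) (binom l k) (binom l (suc k)) ⟩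
  ∂[ k ] U l +ℚ binom l (suc k) *ℚ U (l ∸ k)
    ≡⟨ cong (∂[ k ] U l +ℚ_) (binom-*-∸ U l k) ⟨
  ∂[ k ] U l +ℚ ∂[ suc k ] (λ i → U (suc i)) l ∎

binomialTransform-∂ : ∀ N k (U : ℕ → ℚ) → binomialTransform (∂[ k ] U) N ≡ binom N k *ℚ binomialTransform U (N ∸ k)
binomialTransform-∂ N zero U =
  trans (binomialTransform-cong (λ l → *-identityˡ (U l)) N) (sym (*-identityˡ (binomialTransform U N)))
binomialTransform-∂ zero (suc k) U =
  solve 2 (λ u b → con 1ℚ :* (con 0ℚ :* u) :+ con 0ℚ := con 0ℚ :* b) refl (U 0) (binomialTransform U 0)
binomialTransform-∂ (suc N) (suc k) U = begin
  binomialTransform (∂[ suc k ] U) (suc N)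
    ≡⟨ binomialTransform-suc (∂[ suc k ] U) N ⟩
  binomialTransform (∂[ suc k ] U) N +ℚ binomialTransform (λ l → ∂[ suc k ] U (suc l)) N
    ≡⟨ cong (binomialTransform (∂[ suc k ] U) N +ℚ_)
         (trans (binomialTransform-cong (∂-suc k U) N) (binomialTransform-+ (∂[ k ] U) (∂[ suc k ] U′) N)) ⟩
  binomialTransform (∂[ suc k ] U) N +ℚ (binomialTransform (∂[ k ] U) N +ℚ binomialTransform (∂[ suc k ] U′) N)
    ≡⟨ cong₂ _+ℚ_ (binomialTransform-∂ N (suc k) U)
         (cong₂ _+ℚ_ (binomialTransform-∂ N k U) (binomialTransform-∂ N (suc k) U′)) ⟩
  c′ *ℚ BU (N ∸ suc k) +ℚ (c *ℚ BU (N ∸ k) +ℚ c′ *ℚ binomialTransform U′ (N ∸ suc k))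
    ≡⟨ solve 5 (λ c c′ x y z → c′ :* x :+ (c :* y :+ c′ :* z) := c′ :* (x :+ z) :+ c :* y) refl
         c c′ (BU (N ∸ suc k)) (BU (N ∸ k)) (binomialTransform U′ (N ∸ suc k)) ⟩
  c′ *ℚ (BU (N ∸ suc k) +ℚ binomialTransform U′ (N ∸ suc k)) +ℚ c *ℚ BU (N ∸ k)
    ≡⟨ cong (λ x → c′ *ℚ x +ℚ c *ℚ BU (N ∸ k)) (binomialTransform-suc U (N ∸ suc k)) ⟨
  c′ *ℚ BU (suc (N ∸ suc k)) +ℚ c *ℚ BU (N ∸ k)
    ≡⟨ cong (_+ℚ c *ℚ BU (N ∸ k)) (binom-*-∸ BU N k) ⟩
  c′ *ℚ BU (N ∸ k) +ℚ c *ℚ BU (N ∸ k)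
    ≡⟨ *-distribʳ-+ (BU (N ∸ k)) c′ c ⟨
  (c′ +ℚ c) *ℚ BU (N ∸ k)
    ≡⟨ cong (_*ℚ BU (N ∸ k)) (trans (+-comm c′ c) (sym (binom-pascal N k))) ⟩
  binom (suc N) (suc k) *ℚ BU (suc N ∸ suc k) ∎
  where
  U′ : ℕ → ℚ
  U′ i = U (suc i)
  BU : ℕ → ℚ
  BU = binomialTransform U
  c c′ : ℚ
  c  = binom N k
  c′ = binom N (suc k)

eulerMean : (ℕ → ℚ) → ℕ → ℚ
eulerMean U N = ½ *ℚ (binomialTransform U N +ℚ U N)

eulerMean-∂ : ∀ k (U : ℕ → ℚ) N → eulerMean (∂[ k ] U) N ≡ ∂[ k ] (eulerMean U) N
eulerMean-∂ k U N = begin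
  ½ *ℚ (binomialTransform (∂[ k ] U) N +ℚ c *ℚ U (N ∸ k))
    ≡⟨ cong (λ x → ½ *ℚ (x +ℚ c *ℚ U (N ∸ k))) (binomialTransform-∂ N k U) ⟩
  ½ *ℚ (c *ℚ binomialTransform U (N ∸ k) +ℚ c *ℚ U (N ∸ k))
    ≡⟨ solve 3 (λ c b u → con ½ :* (c :* b :+ c :* u) := c :* (con ½ :* (b :+ u))) refl
         c (binomialTransform U (N ∸ k)) (U (N ∸ k)) ⟩
  c *ℚ eulerMean U (N ∸ k) ∎
  where
  c : ℚ
  c = binom N k

evenInd-* : ∀ n x → evenInd n *ℚ x ≡ ½ *ℚ (x +ℚ sign n *ℚ x)
evenInd-* zero          x = solve 1 (λ x → con 1ℚ :* x := con ½ :* (x :+ con 1ℚ :* x)) refl x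
evenInd-* (suc zero)    x = solve 1 (λ x → con 0ℚ :* x := con ½ :* (x :+ ((:- con 1ℚ) :* con 1ℚ) :* x)) refl x
evenInd-* (suc (suc n)) x = trans (evenInd-* n x) (cong (λ s → ½ *ℚ (x +ℚ s *ℚ x)) (sym (sign-+2 n)))

evenBinomialSum≡Δ^eulerMean : ∀ m (T : ℕ → ℚ) →
  Σ≤ m (λ i → evenInd (m + i) *ℚ (binom m i *ℚ T (m + i))) ≡ Δ^ m (eulerMean T) m
evenBinomialSum≡Δ^eulerMean m T = begin
  Σ≤ m (λ i → evenInd (m + i) *ℚ t i)
    ≡⟨ Σ<-cong (suc m) (λ i → evenInd-* (m + i) (t i)) ⟩
  Σ≤ m (λ i → ½ *ℚ (t i +ℚ sign (m + i) *ℚ t i))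
    ≡⟨ *-distribˡ-Σ< (suc m) ½ (λ i → t i +ℚ sign (m + i) *ℚ t i) ⟨
  ½ *ℚ Σ≤ m (λ i → t i +ℚ sign (m + i) *ℚ t i)
    ≡⟨ cong (½ *ℚ_) (Σ<-+ (suc m) t (λ i → sign (m + i) *ℚ t i)) ⟩
  ½ *ℚ (binomialTransform (λ l → T (m + l)) m +ℚ Σ≤ m (λ i → sign (m + i) *ℚ t i))
    ≡⟨ cong (½ *ℚ_) (cong₂ _+ℚ_ (Δ^-binomialTransform m T m) (Δ^-alternatingSum m T m)) ⟨
  ½ *ℚ (Δ^ m (binomialTransform T) m +ℚ Δ^ m T m)
    ≡⟨ cong (½ *ℚ_) (Δ^-+ m (binomialTransform T) T m) ⟨
  ½ *ℚ Δ^ m (λ l → binomialTransform T l +ℚ T l) m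
    ≡⟨ Δ^-*ˡ m ½ (λ l → binomialTransform T l +ℚ T l) m ⟨
  Δ^ m (eulerMean T) m ∎
  where
  t : ℕ → ℚ
  t i = binom m i *ℚ T (m + i)

-- eulerTable reads earlier entries through lookupℕ, which is local to its where clause and
-- cannot be named. Checking the unfolding below forces the metavariable tableLookup∷ a n m x xs
-- to be that function (with eulerTable's clause variables a n as parameters) applied to x ∷ xs,
-- so tableLookup agrees with it definitionally.
mutual
  tableLookup∷ : ℚ → ℕ → (m : ℕ) → ℚ → Vec ℚ m → ℕ → ℚ
  tableLookup∷ = _

  private
    tableLookup∷-solution : (a : ℚ) (n : ℕ) → toList (eulerTable a (suc n)) ≡ toList (eulerTable a (suc n))
    tableLookup∷-solution a n with suc n | eulerTable a n
    ... | zero  | []     = refl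
    ... | suc m | x ∷ xs = refl {x = toList ((x ∷ xs) ∷ʳ (pow a (suc n) -ℚ ½ *ℚ
            (binom (suc m) 0 *ℚ x +ℚ foldr _+ℚ_ 0ℚ (map (λ k → binom (suc m) k *ℚ tableLookup∷ a n m x xs k) (applyUpTo suc n)))))}

tableLookup : ℚ → ℕ → {m : ℕ} → Vec ℚ m → ℕ → ℚ
tableLookup a n v k = tableLookup∷ a n _ 0ℚ v (suc k)

tableLookup-∷ʳ : ∀ a n {m} (v : Vec ℚ m) x k → k < m → tableLookup a n (v ∷ʳ x) k ≡ tableLookup a n v k
tableLookup-∷ʳ a n (y ∷ ys) x zero    _         = refl
tableLookup-∷ʳ a n (y ∷ ys) x (suc k) (s≤s k<m) = tableLookup-∷ʳ a n ys x k k<m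

tableLookup-∷ʳ-last : ∀ a n {m} (v : Vec ℚ m) x → tableLookup a n (v ∷ʳ x) m ≡ x
tableLookup-∷ʳ-last a n []       x = refl
tableLookup-∷ʳ-last a n (y ∷ ys) x = tableLookup-∷ʳ-last a n ys x

lookup-∷ʳ-fromℕ : ∀ {A : Set} {m} (v : Vec A m) x → lookup (v ∷ʳ x) (fromℕ m) ≡ x
lookup-∷ʳ-fromℕ []       x = refl
lookup-∷ʳ-fromℕ (y ∷ ys) x = lookup-∷ʳ-fromℕ ys x

tableLookup-eulerTable : ∀ b n a N k → k ≤ N → tableLookup b n (eulerTable a N) k ≡ E k a
tableLookup-eulerTable b n a zero    zero    _   = refl
tableLookup-eulerTable b n a (suc N) k       k≤N with m≤n⇒m<n∨m≡n k≤N
... | inj₁ k<1+N = trans (tableLookup-∷ʳ b n (eulerTable a N) _ k k<1+N)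
                         (tableLookup-eulerTable b n a N k (≤-pred k<1+N))
... | inj₂ refl  = trans (tableLookup-∷ʳ-last b n (eulerTable a N) _)
                         (sym (lookup-∷ʳ-fromℕ (eulerTable a N) _))

E-suc : ∀ a n → E (suc n) a ≡ pow a (suc n) -ℚ ½ *ℚ Σ< (suc n) (λ k → binom (suc n) k *ℚ E k a)
E-suc a n = trans (lookup-∷ʳ-fromℕ (eulerTable a n) _)
  (cong (λ s → pow a (suc n) -ℚ ½ *ℚ s) (Σ<-cong-< (suc n) (λ k k<1+n →
    cong (binom (suc n) k *ℚ_) (tableLookup-eulerTable a n a n k (≤-pred k<1+n)))))

eulerMean-E : ∀ a N → eulerMean (λ l → E l a) N ≡ pow a N
eulerMean-E a zero    = refl
eulerMean-E a (suc n) = begin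
  ½ *ℚ (Σ≤ (suc n) (λ l → binom (suc n) l *ℚ E l a) +ℚ E (suc n) a)
    ≡⟨ cong (λ s → ½ *ℚ (s +ℚ E (suc n) a)) (Σ<-sucʳ (suc n) (λ l → binom (suc n) l *ℚ E l a)) ⟩
  ½ *ℚ (Y +ℚ binom (suc n) (suc n) *ℚ E (suc n) a +ℚ E (suc n) a)
    ≡⟨ cong (λ c → ½ *ℚ (Y +ℚ c *ℚ E (suc n) a +ℚ E (suc n) a)) (binom-diag (suc n)) ⟩
  ½ *ℚ (Y +ℚ 1ℚ *ℚ E (suc n) a +ℚ E (suc n) a)
    ≡⟨ cong (λ e → ½ *ℚ (Y +ℚ 1ℚ *ℚ e +ℚ e)) (E-suc a n) ⟩
  ½ *ℚ (Y +ℚ 1ℚ *ℚ (p -ℚ ½ *ℚ Y) +ℚ (p -ℚ ½ *ℚ Y))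
    ≡⟨ solve 2 (λ y p → con ½ :* (y :+ con 1ℚ :* (p :- con ½ :* y) :+ (p :- con ½ :* y)) := p) refl Y p ⟩
  p ∎
  where
  Y p : ℚ
  Y = Σ< (suc n) (λ k → binom (suc n) k *ℚ E k a)
  p = pow a (suc n)

theorem1p12 : (k m : ℕ) → k ≤ m → (a : ℚ) →
    Σ≤ m (λ i → evenInd (m + i) *ℚ (ℕ→ℚ (m C i) *ℚ (ℕ→ℚ ((m + i) C k) *ℚ E ((m + i) ∸ k) a)))
      ≡ Σ≤ m (λ j → sign (m + j) *ℚ (ℕ→ℚ (m C j) *ℚ (ℕ→ℚ ((m + j) C k) *ℚ pow a ((m + j) ∸ k))))
-- The identity holds for every k.
theorem1p12 k m _ a = begin
  Σ≤ m (λ i → evenInd (m + i) *ℚ (binom m i *ℚ ∂[ k ] Eₐ (m + i)))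
    ≡⟨ evenBinomialSum≡Δ^eulerMean m (∂[ k ] Eₐ) ⟩
  Δ^ m (eulerMean (∂[ k ] Eₐ)) m
    ≡⟨ Δ^-cong m (λ N → trans (eulerMean-∂ k Eₐ N) (cong (binom N k *ℚ_) (eulerMean-E a (N ∸ k)))) m ⟩
  Δ^ m (∂[ k ] (pow a)) m
    ≡⟨ Δ^-alternatingSum m (∂[ k ] (pow a)) m ⟩
  Σ≤ m (λ j → sign (m + j) *ℚ (binom m j *ℚ ∂[ k ] (pow a) (m + j))) ∎
  where
  Eₐ : ℕ → ℚ
  Eₐ l = E l a
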